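{- Let $\mathcal B$ be a building set on a finite set $V$, $\mathcal N$ a $\mathcal B$-nested set, and $B\in\mathcal B\setminus\kappa(\mathcal B)$. Then the set $\{C\in\mathcal N:B\subsetneq C\}$ has a unique inclusion-minimal element $M$. Moreover, if $B\notin\mathcal N$, then $M$ is also the unique inclusion-maximal element of $\{C\in\mathcal N:\lambda(C,\mathcal N)\cap B\neq\varnothing\}$.
   Context: A building set on $V$ is a set $\mathcal B$ of non-empty subsets of $V$ containing all singletons such that $B\cap B'\ne\varnothing$ implies $B\cup B'\in\mathcal B$; $\kappa(\mathcal B)$ is its set of inclusion-maximal blocks. A $\mathcal B$-nested set is $\mathcal N\subseteq\mathcal B$ whose members are pairwise nested or disjoint, such that no union of $k\ge2$ pairwise disjoint members belongs to $\mathcal B$, and with $\kappa(\mathcal B)\subseteq\mathcal N$. For $C\in\mathcal N$, its root is $\lambda(C,\mathcal N)=C\setminus\bigcup\{D\in\mathcal N:D\subsetneq C\}$. -}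

module Defs where

open import Data.Nat using (ℕ; _≥_)
open import Data.Fin using (Fin)
open import Data.Fin.Subset public
  using (Subset; _∈_; _∉_; _⊆_; _∩_; _∪_; ⋃; ⁅_⁆; Nonempty; ⊥)
open import Data.List using (List; length)
open import Data.List.Membership.Propositional public
  using () renaming (_∈_ to _∈ᴸ_; _∉_ to _∉ᴸ_)
open import Data.List.Relation.Unary.All using (All)
open import Data.List.Relation.Unary.AllPairs using (AllPairs)
open import Data.Product using (_×_; Σ; ∃)
open import Data.Sum using (_⊎_)
open import Relation.Binary.PropositionalEquality using (_≡_; _≢_)
open import Relation.Nullary using (¬_)

-- Families of subsets of the finite ground set V = Fin n are finite lists of subsets.
Family : ℕ → Set
Family n = List (Subset n)

module _ {n : ℕ} where

  _⊊_ : Subset n → Subset n → Set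
  A ⊊ B = A ⊆ B × A ≢ B

  Disjoint : Subset n → Subset n → Set
  Disjoint A B = ¬ Nonempty (A ∩ B)

  IsBuildingSet : Family n → Set
  IsBuildingSet 𝓑 =
      (∀ B → B ∈ᴸ 𝓑 → Nonempty B)
    × (∀ (i : Fin n) → ⁅ i ⁆ ∈ᴸ 𝓑)
    × (∀ B B' → B ∈ᴸ 𝓑 → B' ∈ᴸ 𝓑 → Nonempty (B ∩ B') → (B ∪ B') ∈ᴸ 𝓑)

  _∈κ_ : Subset n → Family n → Set
  B ∈κ 𝓑 = B ∈ᴸ 𝓑 × (∀ B' → B' ∈ᴸ 𝓑 → B ⊆ B' → B' ≡ B)

  IsNested : Family n → Family n → Set
  IsNested 𝓑 𝓝 =
      (∀ C → C ∈ᴸ 𝓝 → C ∈ᴸ 𝓑)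
    × (∀ C D → C ∈ᴸ 𝓝 → D ∈ᴸ 𝓝 → C ⊆ D ⊎ D ⊆ C ⊎ Disjoint C D)
    × (∀ (Cs : List (Subset n)) → length Cs ≥ 2 → All (_∈ᴸ 𝓝) Cs
         → AllPairs Disjoint Cs → ¬ (⋃ Cs ∈ᴸ 𝓑))
    × (∀ B → B ∈κ 𝓑 → B ∈ᴸ 𝓝)

  -- membership in the root λ(C, 𝓝) = C ∖ ⋃ { D ∈ 𝓝 : D ⊊ C }
  _∈root[_,_] : Fin n → Subset n → Family n → Set
  x ∈root[ C , 𝓝 ] = x ∈ C × (∀ D → D ∈ᴸ 𝓝 → D ⊊ C → x ∉ D)

  IsMinimal : (Subset n → Set) → Subset n → Set
  IsMinimal P M = P M × (∀ C → P C → C ⊆ M → C ≡ M)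

  IsMaximal : (Subset n → Set) → Subset n → Set
  IsMaximal P M = P M × (∀ C → P C → M ⊆ C → C ≡ M)

  UniqueMinimal : (Subset n → Set) → Subset n → Set
  UniqueMinimal P M = IsMinimal P M × (∀ M' → IsMinimal P M' → M' ≡ M)

  UniqueMaximal : (Subset n → Set) → Subset n → Set
  UniqueMaximal P M = IsMaximal P M × (∀ M' → IsMaximal P M' → M' ≡ M)

{-# OPTIONS --safe #-}
-- Since B is not a maximal block it lies strictly inside some maximal block, which belongs
-- to 𝓝; so the members of 𝓝 strictly above B form a non-empty collection, all of whose
-- members share the points of B and are therefore pairwise comparable: its minimal
-- element M is its least element. A member of 𝓝 whose root meets B also shares a point
-- with M, and cannot strictly contain M (its root avoids M), so it lies in M. Finally, if
-- B ∉ 𝓝 and the root of M missed B, then B would be covered by the maximal members of 𝓝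
-- strictly inside M that meet B. These are pairwise disjoint, and since each meets B,
-- adjoining them to B one by one shows that their union is a block; by nestedness there
-- is then at most one of them, and it would contain B, contradicting the minimality of M.
module Submission where

open import Defs
open import Data.Nat using (ℕ; s≤s; z≤n)
open import Data.Fin using (Fin)
import Data.Fin.Properties as Fin
open import Data.Fin.Subset using (_⊂_)
open import Data.Fin.Subset.Properties
  using (_⊆?_; _⊂?_; _∈?_; ⊆-antisym; ⊆-trans; ⊆-reflexive; nonempty?; ∉⊥;
         x∈p∩q⁺; x∈p∩q⁻; x∈p∪q⁺; x∈p∪q⁻; p⊆p∪q; q⊆p∪q; ∪-identityʳ; ∪-assoc; ∪-comm)
open import Data.Fin.Subset.Induction using (Acc; acc; ⊂-wellFounded; ⊃-wellFounded)
open import Data.Bool.Properties using () renaming (_≟_ to _≟ᵇ_)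
open import Data.Vec.Properties using (≡-dec)
open import Data.List using (List; []; _∷_; filter; deduplicate)
open import Data.List.Relation.Unary.All as All using (All; []; _∷_)
open import Data.List.Relation.Unary.AllPairs using (AllPairs; []; _∷_)
open import Data.List.Relation.Unary.Any using (here; there; any?)
open import Data.List.Relation.Unary.Unique.Propositional using (Unique)
open import Data.List.Relation.Unary.Unique.DecPropositional.Properties using (deduplicate-!)
open import Data.List.Membership.Propositional using (find; lose)
open import Data.List.Membership.Propositional.Properties
  using (∈-filter⁺; ∈-filter⁻; ∈-deduplicate⁺; ∈-deduplicate⁻)
open import Data.Product using (_×_; Σ; ∃; _,_; proj₁; proj₂)
open import Data.Sum using (_⊎_; inj₁; inj₂)
open import Data.Empty renaming (⊥ to Empty) using (⊥-elim)
open import Data.Unit using (⊤; tt)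
open import Function using (id)
open import Relation.Binary.PropositionalEquality using (_≡_; _≢_; refl; sym; trans; subst; cong)
open import Relation.Nullary using (¬_; Dec; yes; no)
open import Relation.Nullary.Decidable using (_×-dec_; _→-dec_; ¬?; map′)
open import Relation.Unary using (Decidable)

module _ {n : ℕ} where

  _≟_ : (A B : Subset n) → Dec (A ≡ B)
  _≟_ = ≡-dec _≟ᵇ_

  _⊊?_ : (A B : Subset n) → Dec (A ⊊ B)
  A ⊊? B = (A ⊆? B) ×-dec ¬? (A ≟ B)

  p⊆q∧p⊄q⇒p≡q : {p q : Subset n} → p ⊆ q → ¬ p ⊂ q → p ≡ q
  p⊆q∧p⊄q⇒p≡q {p} {q} p⊆q p⊄q = ⊆-antisym p⊆q q⊆p
    where
    q⊆p : q ⊆ p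
    q⊆p {x} x∈q with x ∈? p
    ... | yes x∈p = x∈p
    ... | no  x∉p = ⊥-elim (p⊄q (p⊆q , x , x∈q , x∉p))

  p⊆q⇒p∪q≡q : {p q : Subset n} → p ⊆ q → p ∪ q ≡ q
  p⊆q⇒p∪q≡q {p} {q} p⊆q = ⊆-antisym p∪q⊆q (q⊆p∪q p q)
    where
    p∪q⊆q : p ∪ q ⊆ q
    p∪q⊆q x∈p∪q with x∈p∪q⁻ p q x∈p∪q
    ... | inj₁ x∈p = p⊆q x∈p
    ... | inj₂ x∈q = x∈q

  ∪-left-comm : (p q r : Subset n) → p ∪ (q ∪ r) ≡ q ∪ (p ∪ r)
  ∪-left-comm p q r = trans (sym (∪-assoc p q r)) (trans (cong (_∪ r) (∪-comm p q)) (∪-assoc q p r))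

  x∈⋃ : ∀ {x C} {Cs : Family n} → C ∈ᴸ Cs → x ∈ C → x ∈ ⋃ Cs
  x∈⋃ {Cs = D ∷ Ds} (here refl) x∈C = x∈p∪q⁺ (inj₁ x∈C)
  x∈⋃ {Cs = D ∷ Ds} (there C∈) x∈C = x∈p∪q⁺ (inj₂ (x∈⋃ C∈ x∈C))

  ∈root? : ∀ x C (𝓝 : Family n) → Dec (x ∈root[ C , 𝓝 ])
  ∈root? x C 𝓝 = (x ∈? C) ×-dec
    map′ (λ all D D∈ → All.lookup all D∈) (λ f → All.tabulate (λ D∈ → f _ D∈))
         (All.all? (λ D → D ⊊? C →-dec ¬? (x ∈? D)) 𝓝)

allPairs-distinct : ∀ {A : Set} {R : A → A → Set} {xs : List A} → Unique xs
                  → (∀ {x y} → x ∈ᴸ xs → y ∈ᴸ xs → x ≢ y → R x y) → AllPairs R xs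
allPairs-distinct [] _ = []
allPairs-distinct (x≢xs ∷ xs!) R-distinct =
  All.tabulate (λ y∈ → R-distinct (here refl) (there y∈) (All.lookup x≢xs y∈))
  ∷ allPairs-distinct xs! (λ x∈ y∈ → R-distinct (there x∈) (there y∈))

module Among {n : ℕ} (L : Family n) {Q : Subset n → Set} (Q? : Decidable Q) where

  Candidate : Subset n → Set
  Candidate C = C ∈ᴸ L × Q C

  private
    ∃candidate? : ∀ {R : Subset n → Set} → Decidable R → Dec (∃ λ C → C ∈ᴸ L × R C)
    ∃candidate? R? = map′ find (λ (_ , C∈ , rC) → lose C∈ rC) (any? R? L)

  minimal-below : ∀ {X} → Candidate X → ∃ λ M → M ⊆ X × IsMinimal Candidate M
  minimal-below = go (⊂-wellFounded _)
    where
    go : ∀ {X} → Acc _⊂_ X → Candidate X → ∃ λ M → M ⊆ X × IsMinimal Candidate M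
    go {X} (acc below) cX with ∃candidate? (λ C → Q? C ×-dec C ⊂? X)
    ... | yes (C , C∈ , qC , C⊂X) =
      let M , M⊆C , minM = go (below C⊂X) (C∈ , qC) in M , ⊆-trans M⊆C (proj₁ C⊂X) , minM
    ... | no ∄ = X , id , cX , λ C (C∈ , qC) C⊆X →
      p⊆q∧p⊄q⇒p≡q C⊆X (λ C⊂X → ∄ (C , C∈ , qC , C⊂X))

  maximal-above : ∀ {X} → Candidate X → ∃ λ M → X ⊆ M × IsMaximal Candidate M
  maximal-above = go (⊃-wellFounded _)
    where
    go : ∀ {X} → Acc (λ A B → B ⊂ A) X → Candidate X → ∃ λ M → X ⊆ M × IsMaximal Candidate M
    go {X} (acc above) cX with ∃candidate? (λ C → Q? C ×-dec X ⊂? C)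
    ... | yes (C , C∈ , qC , X⊂C) =
      let M , C⊆M , maxM = go (above X⊂C) (C∈ , qC) in M , ⊆-trans (proj₁ X⊂C) C⊆M , maxM
    ... | no ∄ = X , id , cX , λ C (C∈ , qC) X⊆C →
      sym (p⊆q∧p⊄q⇒p≡q X⊆C (λ X⊂C → ∄ (C , C∈ , qC , X⊂C)))

  isMaximal? : Decidable (IsMaximal Candidate)
  isMaximal? C = (member? ×-dec Q? C) ×-dec
    map′ (λ all D (D∈ , qD) → All.lookup all D∈ qD) (λ f → All.tabulate (λ D∈ qD → f _ (D∈ , qD)))
         (All.all? (λ D → Q? D →-dec (C ⊆? D →-dec D ≟ C)) L)
    where
    member? : Dec (C ∈ᴸ L)
    member? = map′ (λ (_ , D∈ , D≡C) → subst (_∈ᴸ L) D≡C D∈) (λ C∈ → C , C∈ , refl)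
                   (∃candidate? (_≟ C))

  maximals : Family n
  maximals = deduplicate _≟_ (filter isMaximal? L)

  ∈-maximals⁺ : ∀ {C} → IsMaximal Candidate C → C ∈ᴸ maximals
  ∈-maximals⁺ maxC = ∈-deduplicate⁺ _≟_ (∈-filter⁺ {P = IsMaximal Candidate} isMaximal? (proj₁ (proj₁ maxC)) maxC)

  ∈-maximals⁻ : ∀ {C} → C ∈ᴸ maximals → IsMaximal Candidate C
  ∈-maximals⁻ C∈ = proj₂ (∈-filter⁻ {P = IsMaximal Candidate} isMaximal? {xs = L} (∈-deduplicate⁻ _≟_ (filter isMaximal? L) C∈))

  maximals-unique : Unique maximals
  maximals-unique = deduplicate-! _≟_ (filter isMaximal? L)

module _ {n : ℕ} {𝓑 : Family n} where

  ∃κ-above : ∀ {B} → B ∈ᴸ 𝓑 → ¬ B ∈κ 𝓑 → ∃ λ K → K ∈κ 𝓑 × B ⊊ K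
  ∃κ-above {B} B∈ B∉κ =
    let K , B⊆K , (K∈ , _) , maxK = maximal-above (B∈ , tt)
    in K , (K∈ , λ C C∈ K⊆C → maxK C (C∈ , tt) K⊆C) , B⊆K ,
       λ B≡K → B∉κ (B∈ , λ C C∈ B⊆C → trans (maxK C (C∈ , tt) (subst (_⊆ C) B≡K B⊆C)) (sym B≡K))
    where open Among 𝓑 {Q = λ _ → ⊤} (λ _ → yes tt)

  ∪-⋃-meeting-∈ : IsBuildingSet 𝓑 → ∀ {B} → B ∈ᴸ 𝓑 → ∀ {Ds}
                → All (λ D → D ∈ᴸ 𝓑 × Nonempty (D ∩ B)) Ds → B ∪ ⋃ Ds ∈ᴸ 𝓑
  ∪-⋃-meeting-∈ _ {B} B∈ [] = subst (_∈ᴸ 𝓑) (sym (∪-identityʳ B)) B∈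
  ∪-⋃-meeting-∈ isB {B} B∈ {D ∷ Ds} ((D∈ , x , x∈D∩B) ∷ rest) =
    subst (_∈ᴸ 𝓑) (∪-left-comm D B (⋃ Ds))
      (proj₂ (proj₂ isB) D (B ∪ ⋃ Ds) D∈ (∪-⋃-meeting-∈ isB B∈ rest)
        (x , x∈p∩q⁺ (proj₁ (x∈p∩q⁻ D B x∈D∩B) , p⊆p∪q (⋃ Ds) (proj₂ (x∈p∩q⁻ D B x∈D∩B)))))

  module _ {𝓝 : Family n} (isN : IsNested 𝓑 𝓝) where

    meeting⇒comparable : ∀ {C D x} → C ∈ᴸ 𝓝 → D ∈ᴸ 𝓝 → x ∈ C → x ∈ D → C ⊆ D ⊎ D ⊆ C
    meeting⇒comparable {C} {D} {x} C∈ D∈ x∈C x∈D with proj₁ (proj₂ isN) C D C∈ D∈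
    ... | inj₁ C⊆D = inj₁ C⊆D
    ... | inj₂ (inj₁ D⊆C) = inj₂ D⊆C
    ... | inj₂ (inj₂ C∩D=∅) = ⊥-elim (C∩D=∅ (x , x∈p∩q⁺ (x∈C , x∈D)))

    distinct-maximals-disjoint : ∀ {P : Subset n → Set} → (∀ {C} → P C → C ∈ᴸ 𝓝)
      → ∀ {C D} → IsMaximal P C → IsMaximal P D → C ≢ D → Disjoint C D
    distinct-maximals-disjoint P⊆𝓝 (pC , maxC) (pD , maxD) C≢D (x , x∈C∩D)
      with meeting⇒comparable (P⊆𝓝 pC) (P⊆𝓝 pD) (proj₁ (x∈p∩q⁻ _ _ x∈C∩D)) (proj₂ (x∈p∩q⁻ _ _ x∈C∩D))
    ... | inj₁ C⊆D = C≢D (sym (maxC _ pD C⊆D))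
    ... | inj₂ D⊆C = C≢D (maxD _ pC D⊆C)

module LeastAbove {n : ℕ} {𝓑 𝓝 : Family n} (isB : IsBuildingSet 𝓑) (isN : IsNested 𝓑 𝓝)
                  {B : Subset n} (B∈𝓑 : B ∈ᴸ 𝓑) (B∉κ : ¬ B ∈κ 𝓑) where

  Above : Subset n → Set
  Above C = C ∈ᴸ 𝓝 × B ⊊ C

  RootMeets : Subset n → Set
  RootMeets C = C ∈ᴸ 𝓝 × ∃ λ x → x ∈root[ C , 𝓝 ] × x ∈ B

  minimalAbove : ∃ (IsMinimal Above)
  minimalAbove =
    let K , K∈κ , B⊊K = ∃κ-above B∈𝓑 B∉κ
        M , _ , minM = Among.minimal-below 𝓝 (B ⊊?_) (proj₂ (proj₂ (proj₂ isN)) K K∈κ , B⊊K)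
    in M , minM

  M : Subset n
  M = proj₁ minimalAbove

  M∈𝓝 : M ∈ᴸ 𝓝
  M∈𝓝 = proj₁ (proj₁ (proj₂ minimalAbove))

  B⊆M : B ⊆ M
  B⊆M = proj₁ (proj₂ (proj₁ (proj₂ minimalAbove)))

  M-minimal : ∀ C → Above C → C ⊆ M → C ≡ M
  M-minimal = proj₂ (proj₂ minimalAbove)

  b : Fin n
  b = proj₁ (proj₁ isB B B∈𝓑)

  b∈B : b ∈ B
  b∈B = proj₂ (proj₁ isB B B∈𝓑)

  M-least : ∀ {C} → Above C → M ⊆ C
  M-least {C} (C∈𝓝 , B⊆C , B≢C) with meeting⇒comparable isN M∈𝓝 C∈𝓝 (B⊆M b∈B) (B⊆C b∈B)
  ... | inj₁ M⊆C = M⊆C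
  ... | inj₂ C⊆M = ⊆-reflexive (sym (M-minimal C (C∈𝓝 , B⊆C , B≢C) C⊆M))

  M-uniqueMinimal : UniqueMinimal Above M
  M-uniqueMinimal = proj₂ minimalAbove , λ M' (aboveM' , minM') →
    sym (minM' M (proj₁ (proj₂ minimalAbove)) (M-least aboveM'))

  root-meeting-B⇒⊆M : ∀ {C x} → C ∈ᴸ 𝓝 → x ∈root[ C , 𝓝 ] → x ∈ B → C ⊆ M
  root-meeting-B⇒⊆M {C} C∈𝓝 (x∈C , x∉below) x∈B with meeting⇒comparable isN C∈𝓝 M∈𝓝 x∈C (B⊆M x∈B)
  ... | inj₁ C⊆M = C⊆M
  ... | inj₂ M⊆C with M ≟ C
  ...   | yes M≡C = ⊆-reflexive (sym M≡C)
  ...   | no  M≢C = ⊥-elim (x∉below M M∈𝓝 (M⊆C , M≢C) (B⊆M x∈B))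

  module _ (B∉𝓝 : B ∉ᴸ 𝓝) where

    ⊊M⇒⊉B : ∀ {D} → D ∈ᴸ 𝓝 → D ⊊ M → ¬ B ⊆ D
    ⊊M⇒⊉B D∈𝓝 (D⊆M , D≢M) B⊆D =
      D≢M (M-minimal _ (D∈𝓝 , B⊆D , λ B≡D → B∉𝓝 (subst (_∈ᴸ 𝓝) (sym B≡D) D∈𝓝)) D⊆M)

    no-disjoint-cover-below-M : ∀ {Ds} → All (λ D → D ∈ᴸ 𝓝 × D ⊊ M) Ds → AllPairs Disjoint Ds
                              → ⋃ Ds ∈ᴸ 𝓑 → ¬ B ⊆ ⋃ Ds
    no-disjoint-cover-below-M [] _ _ B⊆∅ = ∉⊥ (B⊆∅ b∈B)
    no-disjoint-cover-below-M ((D∈𝓝 , D⊊M) ∷ []) _ _ B⊆D∪∅ =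
      ⊊M⇒⊉B D∈𝓝 D⊊M (λ x∈B → subst (_ ∈_) (∪-identityʳ _) (B⊆D∪∅ x∈B))
    no-disjoint-cover-below-M below@(_ ∷ _ ∷ _) disjoint ⋃∈𝓑 _ =
      proj₁ (proj₂ (proj₂ isN)) _ (s≤s (s≤s z≤n)) (All.map proj₁ below) disjoint ⋃∈𝓑

    B-covered-below-M⇒⊥ : (∀ {x} → x ∈ B → ∃ λ D → D ∈ᴸ 𝓝 × D ⊊ M × x ∈ D) → Empty
    B-covered-below-M⇒⊥ cover = no-disjoint-cover-below-M below disjoint ⋃∈𝓑 B⊆⋃
      where
      open Among 𝓝 {Q = λ D → D ⊊ M × Nonempty (D ∩ B)} (λ D → D ⊊? M ×-dec nonempty? (D ∩ B))

      B⊆⋃ : B ⊆ ⋃ maximals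
      B⊆⋃ x∈B =
        let D , D∈𝓝 , D⊊M , x∈D = cover x∈B
            Y , D⊆Y , maxY = maximal-above (D∈𝓝 , D⊊M , _ , x∈p∩q⁺ (x∈D , x∈B))
        in x∈⋃ (∈-maximals⁺ maxY) (D⊆Y x∈D)

      ⋃∈𝓑 : ⋃ maximals ∈ᴸ 𝓑
      ⋃∈𝓑 = subst (_∈ᴸ 𝓑) (p⊆q⇒p∪q≡q B⊆⋃) (∪-⋃-meeting-∈ isB B∈𝓑 (All.tabulate λ C∈ →
        let (C∈𝓝 , _ , C∩B≠∅) , _ = ∈-maximals⁻ C∈ in proj₁ isN _ C∈𝓝 , C∩B≠∅))

      disjoint : AllPairs Disjoint maximals
      disjoint = allPairs-distinct maximals-unique λ C∈ D∈ →
        distinct-maximals-disjoint isN proj₁ (∈-maximals⁻ C∈) (∈-maximals⁻ D∈)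

      below : All (λ D → D ∈ᴸ 𝓝 × D ⊊ M) maximals
      below = All.tabulate λ C∈ → let (C∈𝓝 , C⊊M , _) , _ = ∈-maximals⁻ C∈ in C∈𝓝 , C⊊M

    root-M-meets-B : ∃ λ x → x ∈root[ M , 𝓝 ] × x ∈ B
    root-M-meets-B with Fin.any? (λ x → ∈root? x M 𝓝 ×-dec x ∈? B)
    ... | yes found = found
    ... | no ∄ = ⊥-elim (B-covered-below-M⇒⊥ cover)
      where
      cover : ∀ {x} → x ∈ B → ∃ λ D → D ∈ᴸ 𝓝 × D ⊊ M × x ∈ D
      cover {x} x∈B with any? (λ D → D ⊊? M ×-dec x ∈? D) 𝓝
      ... | yes inside = find inside
      ... | no  ∄below = ⊥-elim (∄ (x , (B⊆M x∈B , λ D D∈𝓝 D⊊M x∈D → ∄below (lose D∈𝓝 (D⊊M , x∈D))) , x∈B))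

    M-uniqueMaximal : UniqueMaximal RootMeets M
    M-uniqueMaximal =
      ((M∈𝓝 , root-M-meets-B) , λ C (C∈𝓝 , _ , x∈root , x∈B) M⊆C →
         ⊆-antisym (root-meeting-B⇒⊆M C∈𝓝 x∈root x∈B) M⊆C) ,
      λ M' ((M'∈𝓝 , _ , x∈root , x∈B) , maxM') →
         sym (maxM' M (M∈𝓝 , root-M-meets-B) (root-meeting-B⇒⊆M M'∈𝓝 x∈root x∈B))

lemma3p11 : (n : ℕ) (𝓑 𝓝 : Family n) → IsBuildingSet 𝓑 → IsNested 𝓑 𝓝
    → (B : Subset n) → B ∈ᴸ 𝓑 → ¬ (B ∈κ 𝓑)
    → Σ (Subset n) λ M →
        UniqueMinimal (λ C → C ∈ᴸ 𝓝 × B ⊊ C) M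
        × (B ∉ᴸ 𝓝 → UniqueMaximal (λ C → C ∈ᴸ 𝓝 × ∃ λ x → x ∈root[ C , 𝓝 ] × x ∈ B) M)
lemma3p11 n 𝓑 𝓝 isB isN B B∈𝓑 B∉κ = M , M-uniqueMinimal , M-uniqueMaximal
  where open LeastAbove isB isN B∈𝓑 B∉κ
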